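{- Let $\mathscr{M}=(S,\rho)$ be a matroid scheme and $a\in\mathrm{at}(S)$. (1) If $a$ is neither a loop nor an isthmus, then $T_{\mathscr{M}}(\mathrm{x},\mathrm{y})=T_{\mathscr{M}-a}(\mathrm{x},\mathrm{y})+T_{\mathscr{M}_{/a}}(\mathrm{x},\mathrm{y})$. (2) If $a$ is a loop, then $T_{\mathscr{M}}(\mathrm{x},\mathrm{y})=\mathrm{y}\,T_{\mathscr{M}_{/a}}(\mathrm{x},\mathrm{y})$. (3) If $a$ is an isthmus, then $T_{\mathscr{M}}(\mathrm{x},\mathrm{y})=(\mathrm{x}-1)T_{\mathscr{M}-a}(\mathrm{x},\mathrm{y})+T_{\mathscr{M}_{/a}}(\mathrm{x},\mathrm{y})$.
   Context: A finite poset $S$ is a simplicial poset if it has a unique minimum $\hat 0$, is ranked (rank function with $\mathrm{rank}(\hat0)=0$ increasing by one along covers), and each lower interval $S_{\le x}$ is isomorphic to the Boolean lattice of subsets of the atoms (rank-one elements) below $x$. Write $|x|$ for the rank of $x$, $\mathrm{at}(S)$ for the atoms. For $T\subseteq S$, $\bigvee T$ is the set of minimal common upper bounds, $\bigwedge T$ the set of maximal common lower bounds; $x\vee y=\bigvee\{x,y\}$, $x\wedge y=\bigwedge\{x,y\}$ (a single element when $x\vee y\neq\emptyset$). A matroid scheme is $(S,\rho)$ with $S$ a finite simplicial poset, $\rho:S\to\mathbb{Z}_{\ge0}$, satisfying: (M1) $0\le\rho(x)\le|x|$; (M2) $x\le y\Rightarrow\rho(x)\le\rho(y)$; (M3) $u\in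 x\vee y\Rightarrow\rho(x)+\rho(y)\ge\rho(u)+\rho(x\wedge y)$; (M4) if $\ell\in x\wedge y$ and $\rho(x)=\rho(\ell)$ then $x\vee y\ne\emptyset$; (M5) if $\rho(x)<\rho(y)$ there is an atom $a\le y$, $a\not\le x$, with $x\vee a\ne\emptyset$. The rank $\rho(\mathscr{M})$ is $\rho(u)$ for any maximal $u\in S$ (independent of $u$). An element $x$ is independent if $\rho(x)=|x|$; a basis is a maximal independent element. An atom $a$ is a loop if $\rho(a)=0$, and an isthmus if $a\le b$ for every basis $b$. The deletion is $\mathscr{M}-a=(S_{\not\ge a},\rho|_{S_{\not\ge a}})$ with $S_{\not\ge a}=\{x\in S: x\not\ge a\}$; the contraction is $\mathscr{M}_{/a}=(S_{\ge a},\rho_{/a})$ with $\rho_{/a}(w)=\rho(w)-\rho(a)$; both are matroid schemes. The Tutte polynomial is $T_{\mathscr{M}}(\mathrm{x},\mathrm{y})=\sum_{w\in S}(\mathrm{x}-1)^{\rho(\mathscr{M})-\rho(w)}(\mathrm{y}-1)^{|w|-\rho(w)}$ (for $\mathscr{M}_{/a}$, $|w|$ is the rank of $w$ in $S_{\ge a}$, i.e. $|w|-1$ in $S$, and its rank function is $\rho_{/a}$). -}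

module Defs where

open import Level using (0ℓ)
open import Data.Nat as ℕ using (ℕ; zero; suc; _∸_)
open import Data.Fin using (Fin; zero; suc)
open import Data.Fin.Subset using (Subset; _∈_; _⊆_)
open import Data.Integer as ℤ using (ℤ; _+_; _*_; _-_; _^_; 0ℤ; 1ℤ)
open import Data.Product using (Σ; ∃; _×_; _,_)
open import Data.Bool using (if_then_else_)
open import Function using (_∘_; _⇔_)
open import Relation.Nullary using (¬_; does)
open import Relation.Binary using (Decidable; IsPartialOrder)
open import Relation.Binary.PropositionalEquality using (_≡_; _≢_)

module _ {n : ℕ} (_≤_ : Fin n → Fin n → Set) where

  Lt : Fin n → Fin n → Set
  Lt x y = x ≤ y × x ≢ y

  Covers : Fin n → Fin n → Set
  Covers x y = Lt x y × (∀ z → Lt x z → Lt z y → Data.Empty.⊥)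
    where import Data.Empty

  IsJoinElt : Fin n → Fin n → Fin n → Set
  IsJoinElt x y u = x ≤ u × y ≤ u × (∀ v → x ≤ v → y ≤ v → v ≤ u → v ≡ u)

  IsMeetElt : Fin n → Fin n → Fin n → Set
  IsMeetElt x y l = l ≤ x × l ≤ y × (∀ v → v ≤ x → v ≤ y → l ≤ v → v ≡ l)

  JoinNonempty : Fin n → Fin n → Set
  JoinNonempty x y = ∃ λ u → IsJoinElt x y u

  IsMaximal : Fin n → Set
  IsMaximal u = ∀ v → u ≤ v → v ≡ u

record SimplicialPoset (n : ℕ) : Set₁ where
  field
    _≤_            : Fin n → Fin n → Set
    _≤?_           : Decidable _≤_
    isPartialOrder : IsPartialOrder _≡_ _≤_
    -- unique minimum (uniqueness follows from antisymmetry)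
    𝟘              : Fin n
    𝟘-min          : ∀ x → 𝟘 ≤ x
    rank           : Fin n → ℕ
    rank-𝟘         : rank 𝟘 ≡ 0
    rank-cover     : ∀ x y → Covers _≤_ x y → rank y ≡ suc (rank x)
    -- each lower interval S_{≤x} is isomorphic (as a poset) to the Boolean
    -- lattice of subsets of the atoms (rank-one elements) below x
    boolean        : ∀ x →
      Σ ((y : Fin n) → y ≤ x → Subset n) λ f →
        (∀ y (p : y ≤ x) a → a ∈ f y p → rank a ≡ 1 × a ≤ x)
        × (∀ y z (p : y ≤ x) (q : z ≤ x) → (y ≤ z ⇔ f y p ⊆ f z q))
        × (∀ (A : Subset n) → (∀ a → a ∈ A → rank a ≡ 1 × a ≤ x) →
             ∃ λ y → Σ (y ≤ x) λ p → f y p ≡ A)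

  IsAtom : Fin n → Set
  IsAtom a = rank a ≡ 1

record MatroidScheme (n : ℕ) : Set₁ where
  field
    S  : SimplicialPoset n
  open SimplicialPoset S public
  field
    ρ  : Fin n → ℕ
    M1 : ∀ x → ρ x ℕ.≤ rank x
    M2 : ∀ x y → x ≤ y → ρ x ℕ.≤ ρ y
    M3 : ∀ x y u l → IsJoinElt _≤_ x y u → IsMeetElt _≤_ x y l →
           ρ u ℕ.+ ρ l ℕ.≤ ρ x ℕ.+ ρ y
    M4 : ∀ x y l → IsMeetElt _≤_ x y l → ρ x ≡ ρ l → JoinNonempty _≤_ x y
    M5 : ∀ x y → ρ x ℕ.< ρ y →
           ∃ λ a → IsAtom a × a ≤ y × ¬ (a ≤ x) × JoinNonempty _≤_ x a

  IsLoop : Fin n → Set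
  IsLoop a = ρ a ≡ 0

  Independent : Fin n → Set
  Independent x = ρ x ≡ rank x

  IsBasis : Fin n → Set
  IsBasis b = Independent b × (∀ v → b ≤ v → Independent v → v ≡ b)

  IsIsthmus : Fin n → Set
  IsIsthmus a = ∀ b → IsBasis b → a ≤ b

  IsMaximalDel : Fin n → Fin n → Set
  IsMaximalDel a u = ¬ (a ≤ u) × (∀ v → ¬ (a ≤ v) → u ≤ v → v ≡ u)

  IsMaximalCon : Fin n → Fin n → Set
  IsMaximalCon a u = a ≤ u × (∀ v → a ≤ v → u ≤ v → v ≡ u)

sumℤ : ∀ {n} → (Fin n → ℤ) → ℤ
sumℤ {zero}  f = 0ℤ
sumℤ {suc n} f = f zero + sumℤ (f ∘ suc)

module _ {n : ℕ} (M : MatroidScheme n) where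
  open MatroidScheme M

  -- T_M(x,y), where r = ρ(M) = ρ(u) for a maximal u
  tutte : (r : ℕ) → ℤ → ℤ → ℤ
  tutte r x y = sumℤ λ w →
    ((x - 1ℤ) ^ (r ∸ ρ w)) * ((y - 1ℤ) ^ (rank w ∸ ρ w))

  -- T_{M-a}(x,y): sum over S_{≱a}, rank function ρ restricted,
  -- r = ρ(M-a) = ρ(u) for u maximal in S_{≱a}
  tutteDel : (a : Fin n) (r : ℕ) → ℤ → ℤ → ℤ
  tutteDel a r x y = sumℤ λ w →
    if does (a ≤? w) then 0ℤ
    else ((x - 1ℤ) ^ (r ∸ ρ w)) * ((y - 1ℤ) ^ (rank w ∸ ρ w))

  -- T_{M/a}(x,y): sum over S_{≥a}, rank in S_{≥a} is |w| - 1,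
  -- ρ_{/a}(w) = ρ(w) - ρ(a), r = ρ_{/a}(u) for u maximal in S_{≥a}
  tutteCon : (a : Fin n) (r : ℕ) → ℤ → ℤ → ℤ
  tutteCon a r x y = sumℤ λ w →
    if does (a ≤? w)
    then ((x - 1ℤ) ^ (r ∸ (ρ w ∸ ρ a))) * ((y - 1ℤ) ^ ((rank w ∸ 1) ∸ (ρ w ∸ ρ a)))
    else 0ℤ

module Submission where

-- Split the Tutte sum over S into the elements w ≱ a, which give T_{M-a} once ρ(M-a) is known, and
-- the elements w ≥ a, which give T_{M/a} after the shift |w| ↦ |w|-1, ρ ↦ ρ-ρ(a); always ρ(M/a) =
-- ρ(M)-ρ(a). The ranks follow from submodularity (M3) inside the Boolean lower intervals, where an
-- element is determined by its set of atoms: a basis of M has rank ρ(M), so ρ(M-a) = ρ(M) exactly when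
-- some basis avoids a, and otherwise ρ(M-a) = ρ(M)-1. For a loop, M4 makes w ↦ w ∨ a a well-defined
-- bijection from S_{≱a} onto S_{≥a} preserving ρ and raising |w| by one, so T_{M-a} = T_{M/a}, while on
-- S_{≥a} every w is dependent, which contributes the factor y-1.

open import Defs
open import Level using (0ℓ)
open import Data.Nat using (ℕ; zero; suc; _∸_; _<_; s≤s)
import Data.Nat as ℕ
import Data.Nat.Properties as ℕ
open import Data.Fin using (Fin; zero; suc; _≟_)
open import Data.Fin.Properties using (all?; ¬∀⟶∃¬)
open import Data.Bool using (true; false; if_then_else_)
open import Data.Product using (Σ; ∃; _×_; _,_; proj₁; proj₂)
import Data.Sum as Sum
open import Data.Sum using (_⊎_; inj₁; inj₂; [_,_]′)
open import Data.Unit using (⊤; tt)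
open import Data.Empty using (⊥; ⊥-elim)
open import Function using (_∘_; _⇔_; mk⇔; Equivalence)
open import Relation.Nullary using (¬_; Dec; yes; no; does; contradiction)
open import Relation.Nullary.Decidable using (dec-true; dec-false; _×-dec_; _→-dec_)
open import Relation.Unary using (Pred; Decidable)
open import Relation.Binary using (Rel; IsPartialOrder) renaming (Decidable to Decidable₂)
open import Relation.Binary.PropositionalEquality
  using (_≡_; _≢_; _≗_; refl; sym; trans; cong; cong₂; subst; subst₂; module ≡-Reasoning)

module FinSubsetProperties where
  open import Data.Fin.Subset
  open import Data.Fin.Subset.Properties
  open import Data.Vec using (_∷_; here; there; tabulate)
  open import Data.Vec.Properties using (lookup∘tabulate; []=⇒lookup; lookup⇒[]=)

  private variable n : ℕ

  x∉p-x : ∀ (p : Subset n) x → x ∉ p - x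
  x∉p-x (_ ∷ p) zero    ()
  x∉p-x (_ ∷ p) (suc x) (there x∈p-x) = x∉p-x p x x∈p-x

  x∈p-y⇔ : ∀ {x y} {p : Subset n} → x ∈ p - y ⇔ (x ∈ p × x ≢ y)
  x∈p-y⇔ {x = x} {y} {p} = mk⇔
    (λ x∈ → p─q⊆p p ⁅ y ⁆ x∈ , λ { refl → x∉p-x p x x∈ })
    (λ (x∈p , x≢y) → x∈p∧x≢y⇒x∈p-y x∈p x≢y)

  x∈p∪⁅y⁆⁻ : ∀ {x y} (p : Subset n) → x ∈ p ∪ ⁅ y ⁆ → x ∈ p ⊎ x ≡ y
  x∈p∪⁅y⁆⁻ {y = y} p x∈ with x∈p∪q⁻ p ⁅ y ⁆ x∈
  ... | inj₁ x∈p  = inj₁ x∈p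
  ... | inj₂ x∈⁅y⁆ = inj₂ (x∈⁅y⁆⇒x≡y y x∈⁅y⁆)

  ∣p∪⁅x⁆∣≡1+∣p∣ : ∀ {x} (p : Subset n) → x ∉ p → ∣ p ∪ ⁅ x ⁆ ∣ ≡ suc ∣ p ∣
  ∣p∪⁅x⁆∣≡1+∣p∣ {x = zero}  (true  ∷ p) x∉p = contradiction here x∉p
  ∣p∪⁅x⁆∣≡1+∣p∣ {x = zero}  (false ∷ p) x∉p = cong (suc ∘ ∣_∣) (∪-identityʳ p)
  ∣p∪⁅x⁆∣≡1+∣p∣ {x = suc x} (true  ∷ p) x∉p = cong suc (∣p∪⁅x⁆∣≡1+∣p∣ p (x∉p ∘ there))
  ∣p∪⁅x⁆∣≡1+∣p∣ {x = suc x} (false ∷ p) x∉p = ∣p∪⁅x⁆∣≡1+∣p∣ p (x∉p ∘ there)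

  x∈p⇒∣p∣≡1+∣p-x∣ : ∀ {x} (p : Subset n) → x ∈ p → ∣ p ∣ ≡ suc ∣ p - x ∣
  x∈p⇒∣p∣≡1+∣p-x∣ {x = zero}  (true ∷ p) here       = cong (suc ∘ ∣_∣) (sym (p─⊥≡p p))
  x∈p⇒∣p∣≡1+∣p-x∣ {x = suc x} (true  ∷ p) (there x∈p) = cong suc (x∈p⇒∣p∣≡1+∣p-x∣ p x∈p)
  x∈p⇒∣p∣≡1+∣p-x∣ {x = suc x} (false ∷ p) (there x∈p) = x∈p⇒∣p∣≡1+∣p-x∣ p x∈p

  ∣p∣≡0⇒x∉p : ∀ {x} (p : Subset n) → ∣ p ∣ ≡ 0 → x ∉ p
  ∣p∣≡0⇒x∉p p ∣p∣≡0 x∈p = ℕ.0≢1+n (trans (sym ∣p∣≡0) (x∈p⇒∣p∣≡1+∣p-x∣ p x∈p))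

  ∣p∣≡1⇒x∈p⇒y∈p⇒x≡y : ∀ {x y} (p : Subset n) → ∣ p ∣ ≡ 1 → x ∈ p → y ∈ p → x ≡ y
  ∣p∣≡1⇒x∈p⇒y∈p⇒x≡y {x = x} {y} p ∣p∣≡1 x∈p y∈p with y ≟ x
  ... | yes y≡x = sym y≡x
  ... | no  y≢x = contradiction (x∈p∧x≢y⇒x∈p-y y∈p y≢x)
    (∣p∣≡0⇒x∉p (p - x) (ℕ.suc-injective (trans (sym (x∈p⇒∣p∣≡1+∣p-x∣ p x∈p)) ∣p∣≡1)))

  ∣p∣≢0⇒Nonempty : ∀ (p : Subset n) → ∣ p ∣ ≢ 0 → Nonempty p
  ∣p∣≢0⇒Nonempty {n} p ∣p∣≢0 with nonempty? p
  ... | yes ne = ne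
  ... | no ¬ne = contradiction (trans (cong ∣_∣ (Empty-unique ¬ne)) (∣⊥∣≡0 n)) ∣p∣≢0

  p⊆q⇒∣q∣≤∣p∣⇒q⊆p : ∀ {p q : Subset n} → p ⊆ q → ∣ q ∣ ℕ.≤ ∣ p ∣ → q ⊆ p
  p⊆q⇒∣q∣≤∣p∣⇒q⊆p {p = p} p⊆q ∣q∣≤∣p∣ {x} x∈q with x ∈? p
  ... | yes x∈p = x∈p
  ... | no  x∉p = contradiction ∣q∣≤∣p∣ (ℕ.<⇒≱ (p⊂q⇒∣p∣<∣q∣ (p⊆q , x , x∈q , x∉p)))

  ∈-tabulate-does : ∀ {P : Pred (Fin n) 0ℓ} (P? : Decidable P) {x} → x ∈ tabulate (does ∘ P?) ⇔ P x
  ∈-tabulate-does P? {x} = mk⇔ to from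
    where
    to : x ∈ tabulate (does ∘ P?) → _
    to x∈ with P? x | trans (sym (lookup∘tabulate (does ∘ P?) x)) ([]=⇒lookup x∈)
    ... | yes Px | _ = Px
    ... | no  _  | ()
    from : _ → x ∈ tabulate (does ∘ P?)
    from Px = lookup⇒[]= x _ (trans (lookup∘tabulate (does ∘ P?) x) (dec-true (P? x) Px))

  p⊈q⇒∃∈p∉q : ∀ {p q : Subset n} → ¬ p ⊆ q → ∃ λ x → x ∈ p × x ∉ q
  p⊈q⇒∃∈p∉q {n} {p} {q} p⊈q with ¬∀⟶∃¬ n (λ x → x ∈ p → x ∈ q) (λ x → x ∈? p →-dec x ∈? q) (λ p→q → p⊈q (p→q _))
  ... | x , ¬[x∈p→x∈q] with x ∈? p
  ...   | yes x∈p = x , x∈p , λ x∈q → ¬[x∈p→x∈q] λ _ → x∈q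
  ...   | no  x∉p = contradiction (λ x∈p → contradiction x∈p x∉p) ¬[x∈p→x∈q]

open FinSubsetProperties

MaximalIn : ∀ {n} → Rel (Fin n) 0ℓ → Pred (Fin n) 0ℓ → Pred (Fin n) 0ℓ
MaximalIn _≤_ P m = P m × ∀ v → P v → m ≤ v → v ≡ m

module _ {n} {_≤_ : Rel (Fin n) 0ℓ} (isPartialOrder : IsPartialOrder _≡_ _≤_) (_≤?_ : Decidable₂ _≤_) where
  open IsPartialOrder isPartialOrder using (antisym) renaming (refl to ≤-refl; trans to ≤-trans)
  open import Data.List using (List; []; _∷_; allFin)
  open import Data.List.Membership.Propositional using () renaming (_∈_ to _∈ₗ_)
  open import Data.List.Membership.Propositional.Properties using (∈-allFin)
  open import Data.List.Relation.Unary.Any using (here; there)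

  maximal-above : ∀ {P : Pred (Fin n) 0ℓ} → Decidable P → ∀ {c} → P c → ∃ λ m → MaximalIn _≤_ P m × c ≤ m
  maximal-above {P} P? Pc =
    let m , (Pm , m-max) , c≤m = go (allFin n) Pc in m , (Pm , λ v → m-max v (∈-allFin v)) , c≤m
    where
    go : ∀ (L : List (Fin n)) {c} → P c → ∃ λ m → (P m × ∀ v → v ∈ₗ L → P v → m ≤ v → v ≡ m) × c ≤ m
    go [] {c} Pc = c , (Pc , λ _ ()) , ≤-refl
    go (w ∷ L) {c} Pc with P? w ×-dec c ≤? w
    ... | yes (Pw , c≤w) = let m , (Pm , m-max) , w≤m = go L Pw in
      m , (Pm , λ { v (here refl) _ m≤v → antisym w≤m m≤v ; v (there v∈L) → m-max v v∈L }) , ≤-trans c≤w w≤m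
    ... | no ¬Pw×c≤w = let m , (Pm , m-max) , c≤m = go L Pc in
      m , (Pm , λ { v (here refl) Pv m≤v → contradiction (Pv , ≤-trans c≤m m≤v) ¬Pw×c≤w
                  ; v (there v∈L) → m-max v v∈L }) , c≤m

module SimplicialPosetProperties {n : ℕ} (S : SimplicialPoset n) where
  open SimplicialPoset S
  open import Data.Fin.Subset hiding (⊥)
  open import Data.Fin.Subset.Properties
  open import Data.Vec using (tabulate)
  open IsPartialOrder isPartialOrder public
    using (antisym) renaming (refl to ≤-refl; trans to ≤-trans)
  open Equivalence using (to; from)

  AtomsBelow : Fin n → Subset n → Set
  AtomsBelow x T = ∀ a → a ∈ T → IsAtom a × a ≤ x

  -- The isomorphism given by the axiom `boolean` need not send y to the set of atoms below y;
  -- `atoms` below is the canonical representation, derived from it.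
  record BooleanRepresentation (x : Fin n) : Set where
    field
      set       : ∀ y → y ≤ x → Subset n
      set-atoms : ∀ y (p : y ≤ x) → AtomsBelow x (set y p)
      ≤⇔⊆       : ∀ y z (p : y ≤ x) (q : z ≤ x) → y ≤ z ⇔ set y p ⊆ set z q
      set-onto  : ∀ T → AtomsBelow x T → ∃ λ y → Σ (y ≤ x) λ p → set y p ≡ T

    ≤⇒⊆ : ∀ {y z} {p : y ≤ x} {q : z ≤ x} → y ≤ z → set y p ⊆ set z q
    ≤⇒⊆ {p = p} {q} = to (≤⇔⊆ _ _ p q)

    ⊆⇒≤ : ∀ {y z} {p : y ≤ x} {q : z ≤ x} → set y p ⊆ set z q → y ≤ z
    ⊆⇒≤ {p = p} {q} = from (≤⇔⊆ _ _ p q)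

    covers-set-minus : ∀ {y w s} {p : y ≤ x} {q : w ≤ x} →
      set w q ≡ set y p - s → s ∈ set y p → Covers _≤_ w y
    covers-set-minus {y} {w} {s} {p} {q} set-w s∈y =
      (⊆⇒≤ (proj₁ ∘ to x∈p-y⇔ ∘ ∈w⇒) , w≢y) , no-between
      where
      ∈w⇒ : ∀ {e} → e ∈ set w q → e ∈ set y p - s
      ∈w⇒ = subst (_ ∈_) set-w
      ∈w⇐ : ∀ {e} → e ∈ set y p → e ≢ s → e ∈ set w q
      ∈w⇐ e∈y e≢s = subst (_ ∈_) (sym set-w) (x∈p∧x≢y⇒x∈p-y e∈y e≢s)
      w≢y : w ≢ y
      w≢y refl = x∉p-x (set y p) s (∈w⇒ (≤⇒⊆ ≤-refl s∈y))
      no-between : ∀ z → Lt _≤_ w z → Lt _≤_ z y → ⊥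
      no-between z (w≤z , w≢z) (z≤y , z≢y) with s ∈? set z (≤-trans z≤y p)
      ... | yes s∈z = z≢y (antisym z≤y (⊆⇒≤ y⊆z))
        where
        y⊆z : set y p ⊆ set z (≤-trans z≤y p)
        y⊆z {e} e∈y with e ≟ s
        ... | yes refl = s∈z
        ... | no  e≢s  = ≤⇒⊆ w≤z (∈w⇐ e∈y e≢s)
      ... | no  s∉z = w≢z (antisym w≤z (⊆⇒≤ z⊆w))
        where
        z⊆w : set z (≤-trans z≤y p) ⊆ set w q
        z⊆w {e} e∈z = ∈w⇐ (≤⇒⊆ z≤y e∈z) λ { refl → s∉z e∈z }

    rank≡∣set∣ : ∀ {y} (p : y ≤ x) → rank y ≡ ∣ set y p ∣
    rank≡∣set∣ p = go _ p refl
      where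
      go : ∀ k {y} (p : y ≤ x) → ∣ set y p ∣ ≡ k → rank y ≡ k
      go zero {y} p ∣y∣≡0 =
        trans (cong rank (antisym (⊆⇒≤ {q = 𝟘-min x} (⊥-elim ∘ ∣p∣≡0⇒x∉p _ ∣y∣≡0)) (𝟘-min y)))
              rank-𝟘
      go (suc k) {y} p ∣y∣≡1+k =
        trans (rank-cover w y (covers-set-minus set-w s∈y)) (cong suc (go k q ∣w∣≡k))
        where
        s∈ = ∣p∣≢0⇒Nonempty (set y p) λ ∣y∣≡0 → ℕ.0≢1+n (trans (sym ∣y∣≡0) ∣y∣≡1+k)
        s = proj₁ s∈
        s∈y = proj₂ s∈
        w-spec = set-onto (set y p - s) λ a → set-atoms y p a ∘ proj₁ ∘ to x∈p-y⇔
        w = proj₁ w-spec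
        q = proj₁ (proj₂ w-spec)
        set-w = proj₂ (proj₂ w-spec)
        ∣w∣≡k : ∣ set w q ∣ ≡ k
        ∣w∣≡k = trans (cong ∣_∣ set-w) (ℕ.suc-injective (trans (sym (x∈p⇒∣p∣≡1+∣p-x∣ _ s∈y)) ∣y∣≡1+k))

    ∈-set⇒atom : ∀ {y s} {p : y ≤ x} → s ∈ set y p →
      ∃ λ t → IsAtom t × t ≤ y × Σ (t ≤ x) λ q → s ∈ set t q
    ∈-set⇒atom {y} {s} {p} s∈y =
      t , trans (rank≡∣set∣ q) (trans (cong ∣_∣ set-t) (∣⁅x⁆∣≡1 s)) ,
      ⊆⇒≤ (λ e∈t → subst (_∈ set y p) (sym (x∈⁅y⁆⇒x≡y s (subst (_ ∈_) set-t e∈t))) s∈y) ,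
      q , subst (s ∈_) (sym set-t) (x∈⁅x⁆ s)
      where
      t-spec = set-onto ⁅ s ⁆ λ a a∈ →
        subst (λ b → IsAtom b × b ≤ x) (sym (x∈⁅y⁆⇒x≡y s a∈)) (set-atoms y p s s∈y)
      t = proj₁ t-spec
      q = proj₁ (proj₂ t-spec)
      set-t = proj₂ (proj₂ t-spec)

    atom-set-⊆-∪ : ∀ {d} {p : d ≤ x} {U V : Subset n} → IsAtom d →
      set d p ⊆ U ∪ V → set d p ⊆ U ⊎ set d p ⊆ V
    atom-set-⊆-∪ {d} {p} {U} {V} rd d⊆U∪V = Sum.map only-τ only-τ (x∈p∪q⁻ U V (d⊆U∪V τ∈d))
      where
      ∣d∣≡1 = trans (sym (rank≡∣set∣ p)) rd
      τ∈d = proj₂ (∣p∣≢0⇒Nonempty (set d p) λ ∣d∣≡0 → ℕ.0≢1+n (trans (sym ∣d∣≡0) ∣d∣≡1))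
      only-τ : ∀ {W} → _ ∈ W → set d p ⊆ W
      only-τ τ∈W e∈d = subst (_∈ _) (∣p∣≡1⇒x∈p⇒y∈p⇒x≡y (set d p) ∣d∣≡1 τ∈d e∈d) τ∈W

  boolean-representation : ∀ x → BooleanRepresentation x
  boolean-representation x = let f , f-atoms , f-≤⇔⊆ , f-onto = boolean x in record
    { set = f ; set-atoms = f-atoms ; ≤⇔⊆ = f-≤⇔⊆ ; set-onto = f-onto }

  ≤∧rank≥⇒≡ : ∀ {y z} → y ≤ z → rank z ℕ.≤ rank y → y ≡ z
  ≤∧rank≥⇒≡ {y} {z} y≤z rz≤ry = antisym y≤z (⊆⇒≤ (p⊆q⇒∣q∣≤∣p∣⇒q⊆p (≤⇒⊆ y≤z)
    (subst₂ ℕ._≤_ (rank≡∣set∣ ≤-refl) (rank≡∣set∣ y≤z) rz≤ry)))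
    where open BooleanRepresentation (boolean-representation z)

  atom≤atom⇒≡ : ∀ {c d} → IsAtom c → IsAtom d → c ≤ d → c ≡ d
  atom≤atom⇒≡ rc rd c≤d = ≤∧rank≥⇒≡ c≤d (ℕ.≤-reflexive (trans rd (sym rc)))

  IsAtomBelow : Fin n → Fin n → Set
  IsAtomBelow y c = IsAtom c × c ≤ y

  isAtomBelow? : ∀ y c → Dec (IsAtomBelow y c)
  isAtomBelow? y c = rank c ℕ.≟ 1 ×-dec c ≤? y

  atoms : Fin n → Subset n
  atoms y = tabulate (does ∘ isAtomBelow? y)

  ∈-atoms⇔ : ∀ {c y} → c ∈ atoms y ⇔ IsAtomBelow y c
  ∈-atoms⇔ {y = y} = ∈-tabulate-does (isAtomBelow? y)

  ∈-atoms : ∀ {c y} → IsAtom c → c ≤ y → c ∈ atoms y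
  ∈-atoms rc c≤y = from ∈-atoms⇔ (rc , c≤y)

  ∈-atoms⇒≤ : ∀ {c y} → c ∈ atoms y → c ≤ y
  ∈-atoms⇒≤ = proj₂ ∘ to ∈-atoms⇔

  atoms-mono : ∀ {y z} → y ≤ z → atoms y ⊆ atoms z
  atoms-mono y≤z c∈y = let rc , c≤y = to ∈-atoms⇔ c∈y in ∈-atoms rc (≤-trans c≤y y≤z)

  ∈-atoms-atom : ∀ {a c} → IsAtom a → c ∈ atoms a → c ≡ a
  ∈-atoms-atom ra c∈a = let rc , c≤a = to ∈-atoms⇔ c∈a in atom≤atom⇒≡ rc ra c≤a

  atoms-reflects-≤ : ∀ {x y z} → y ≤ x → z ≤ x → atoms y ⊆ atoms z → y ≤ z
  atoms-reflects-≤ {x} p q y⊆z = ⊆⇒≤ {p = p} {q = q} λ s∈y →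
    let t , rt , t≤y , _ , s∈t = ∈-set⇒atom s∈y in ≤⇒⊆ (∈-atoms⇒≤ (y⊆z (∈-atoms rt t≤y))) s∈t
    where open BooleanRepresentation (boolean-representation x)

  atoms-injective : ∀ {x y z} → y ≤ x → z ≤ x → atoms y ≡ atoms z → y ≡ z
  atoms-injective p q y≡z =
    antisym (atoms-reflects-≤ p q (⊆-reflexive y≡z)) (atoms-reflects-≤ q p (⊆-reflexive (sym y≡z)))

  ∉-atoms-𝟘 : ∀ {c} → c ∉ atoms 𝟘
  ∉-atoms-𝟘 c∈𝟘 = let rc , c≤𝟘 = to ∈-atoms⇔ c∈𝟘 in
    ℕ.0≢1+n (trans (sym rank-𝟘) (trans (cong rank (antisym (𝟘-min _) c≤𝟘)) rc))

  atoms-onto : ∀ {x} T → AtomsBelow x T → ∃ λ y → y ≤ x × atoms y ≡ T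
  atoms-onto {x} T T-atoms = go _ T T-atoms refl
    where
    open BooleanRepresentation (boolean-representation x)
    go : ∀ k T → AtomsBelow x T → ∣ T ∣ ≡ k → ∃ λ y → y ≤ x × atoms y ≡ T
    go zero T _ ∣T∣≡0 = 𝟘 , 𝟘-min x , ⊆-antisym (⊥-elim ∘ ∉-atoms-𝟘) (⊥-elim ∘ ∣p∣≡0⇒x∉p T ∣T∣≡0)
    go (suc k) T T-atoms ∣T∣≡1+k = y , q , ⊆-antisym y⊆T T⊆y
      where
      c∈ = ∣p∣≢0⇒Nonempty T λ ∣T∣≡0 → ℕ.0≢1+n (trans (sym ∣T∣≡0) ∣T∣≡1+k)
      c = proj₁ c∈
      c∈T = proj₂ c∈
      pc = proj₂ (T-atoms c c∈T)
      y′-spec = go k (T - c) (λ a → T-atoms a ∘ proj₁ ∘ to x∈p-y⇔)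
                  (ℕ.suc-injective (trans (sym (x∈p⇒∣p∣≡1+∣p-x∣ T c∈T)) ∣T∣≡1+k))
      y′ = proj₁ y′-spec
      p′ = proj₁ (proj₂ y′-spec)
      atoms-y′ = proj₂ (proj₂ y′-spec)
      U = set y′ p′ ∪ set c pc
      y-spec = set-onto U λ a a∈U → [ set-atoms y′ p′ a , set-atoms c pc a ]′ (x∈p∪q⁻ _ _ a∈U)
      y = proj₁ y-spec
      q = proj₁ (proj₂ y-spec)
      set-y = proj₂ (proj₂ y-spec)
      y′≤y : y′ ≤ y
      y′≤y = ⊆⇒≤ λ e∈y′ → subst (_ ∈_) (sym set-y) (p⊆p∪q (set c pc) e∈y′)
      c≤y : c ≤ y
      c≤y = ⊆⇒≤ λ e∈c → subst (_ ∈_) (sym set-y) (q⊆p∪q (set y′ p′) _ e∈c)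
      y⊆T : atoms y ⊆ T
      y⊆T {d} d∈y = [ below-y′ , below-c ]′ (atom-set-⊆-∪ rd d⊆U)
        where
        rd = proj₁ (to ∈-atoms⇔ d∈y)
        d≤y = proj₂ (to ∈-atoms⇔ d∈y)
        pd = ≤-trans d≤y q
        d⊆U : set d pd ⊆ U
        d⊆U = subst (set d pd ⊆_) set-y (≤⇒⊆ d≤y)
        below-y′ : set d pd ⊆ set y′ p′ → d ∈ T
        below-y′ d⊆y′ = proj₁ (to x∈p-y⇔ (subst (d ∈_) atoms-y′ (∈-atoms rd (⊆⇒≤ d⊆y′))))
        below-c : set d pd ⊆ set c pc → d ∈ T
        below-c d⊆c = subst (_∈ T) (sym (atom≤atom⇒≡ rd (proj₁ (T-atoms c c∈T)) (⊆⇒≤ d⊆c))) c∈T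
      T⊆y : T ⊆ atoms y
      T⊆y {d} d∈T with d ≟ c
      ... | yes refl = ∈-atoms (proj₁ (T-atoms c c∈T)) c≤y
      ... | no  d≢c  = atoms-mono y′≤y (subst (d ∈_) (sym atoms-y′) (x∈p∧x≢y⇒x∈p-y d∈T d≢c))

  atoms-representation : ∀ x → BooleanRepresentation x
  atoms-representation x = record
    { set       = λ y _ → atoms y
    ; set-atoms = λ y p a a∈y → let ra , a≤y = to ∈-atoms⇔ a∈y in ra , ≤-trans a≤y p
    ; ≤⇔⊆       = λ y z p q → mk⇔ atoms-mono (atoms-reflects-≤ p q)
    ; set-onto  = λ T T-atoms → let y , p , atoms-y = atoms-onto T T-atoms in y , p , atoms-y
    }

  rank≡∣atoms∣ : ∀ y → rank y ≡ ∣ atoms y ∣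
  rank≡∣atoms∣ y = BooleanRepresentation.rank≡∣set∣ (atoms-representation y) ≤-refl

  join-sym : ∀ {y z v} → IsJoinElt _≤_ y z v → IsJoinElt _≤_ z y v
  join-sym (y≤v , z≤v , minimal) = z≤v , y≤v , λ w z≤w y≤w → minimal w y≤w z≤w

  meet-sym : ∀ {y z l} → IsMeetElt _≤_ y z l → IsMeetElt _≤_ z y l
  meet-sym (l≤y , l≤z , maximal) = l≤z , l≤y , λ v v≤z v≤y → maximal v v≤y v≤z

  join-from-atoms : ∀ {y z v} → y ≤ v → z ≤ v → atoms v ⊆ atoms y ∪ atoms z → IsJoinElt _≤_ y z v
  join-from-atoms y≤v z≤v v⊆y∪z = y≤v , z≤v , λ w y≤w z≤w w≤v →
    antisym w≤v (atoms-reflects-≤ ≤-refl w≤v λ c∈v →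
      [ atoms-mono y≤w , atoms-mono z≤w ]′ (x∈p∪q⁻ _ _ (v⊆y∪z c∈v)))

  meet-from-atoms : ∀ {y z l} → l ≤ y → l ≤ z →
    (∀ {c} → c ∈ atoms y → c ∈ atoms z → c ∈ atoms l) → IsMeetElt _≤_ y z l
  meet-from-atoms l≤y l≤z y∩z⊆l = l≤y , l≤z , λ v v≤y v≤z l≤v →
    antisym (atoms-reflects-≤ v≤y l≤y λ c∈v → y∩z⊆l (atoms-mono v≤y c∈v) (atoms-mono v≤z c∈v)) l≤v

  join-below : ∀ {y z t} → y ≤ t → z ≤ t →
    ∃ λ v → v ≤ t × IsJoinElt _≤_ y z v × atoms v ≡ atoms y ∪ atoms z
  join-below {y} {z} {t} y≤t z≤t =
    v , v≤t ,
    join-from-atoms (reflect {q = y≤t} (p⊆p∪q (atoms z))) (reflect {q = z≤t} (q⊆p∪q (atoms y) _))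
      (⊆-reflexive atoms-v) ,
    atoms-v
    where
    below-t : AtomsBelow _ (atoms y ∪ atoms z)
    below-t c c∈ = [ to ∈-atoms⇔ ∘ atoms-mono y≤t , to ∈-atoms⇔ ∘ atoms-mono z≤t ]′ (x∈p∪q⁻ _ _ c∈)
    v-spec = atoms-onto (atoms y ∪ atoms z) below-t
    v = proj₁ v-spec
    v≤t = proj₁ (proj₂ v-spec)
    atoms-v = proj₂ (proj₂ v-spec)
    reflect : ∀ {w} {q : w ≤ t} → atoms w ⊆ atoms y ∪ atoms z → w ≤ v
    reflect {q = q} w⊆ = atoms-reflects-≤ q v≤t (subst (_ ⊆_) (sym atoms-v) w⊆)

  atoms-join : ∀ {y z v} → IsJoinElt _≤_ y z v → atoms v ≡ atoms y ∪ atoms z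
  atoms-join (y≤v , z≤v , minimal) =
    let w , w≤v , (y≤w , z≤w , _) , atoms-w = join-below y≤v z≤v in
    subst (λ u → atoms u ≡ _) (minimal w y≤w z≤w w≤v) atoms-w

  atoms-atom : ∀ {a} → IsAtom a → atoms a ≡ ⁅ a ⁆
  atoms-atom {a} ra = ⊆-antisym
    (λ c∈a → subst (_∈ ⁅ a ⁆) (sym (∈-atoms-atom ra c∈a)) (x∈⁅x⁆ a))
    (λ c∈⁅a⁆ → subst (_∈ atoms a) (sym (x∈⁅y⁆⇒x≡y a c∈⁅a⁆)) (∈-atoms ra ≤-refl))

  atoms-join-atom : ∀ {a w j} → IsAtom a → IsJoinElt _≤_ w a j → atoms j ≡ atoms w ∪ ⁅ a ⁆
  atoms-join-atom {w = w} ra w∨a = trans (atoms-join w∨a) (cong (atoms w ∪_) (atoms-atom ra))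

  rank-join-atom : ∀ {a w j} → IsAtom a → ¬ a ≤ w → IsJoinElt _≤_ w a j → rank j ≡ suc (rank w)
  rank-join-atom {a} {w} {j} ra a≰w w∨a = begin
    rank j                 ≡⟨ rank≡∣atoms∣ j ⟩
    ∣ atoms j ∣            ≡⟨ cong ∣_∣ (atoms-join-atom ra w∨a) ⟩
    ∣ atoms w ∪ ⁅ a ⁆ ∣    ≡⟨ ∣p∪⁅x⁆∣≡1+∣p∣ (atoms w) (a≰w ∘ ∈-atoms⇒≤) ⟩
    suc ∣ atoms w ∣        ≡⟨ cong suc (rank≡∣atoms∣ w) ⟨
    suc (rank w)           ∎
    where open ≡-Reasoning

  meet-atom : ∀ {a w} → IsAtom a → ¬ a ≤ w → IsMeetElt _≤_ w a 𝟘
  meet-atom ra a≰w = meet-from-atoms (𝟘-min _) (𝟘-min _) λ c∈w c∈a →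
    ⊥-elim (a≰w (subst (_≤ _) (∈-atoms-atom ra c∈a) (∈-atoms⇒≤ c∈w)))

  ≤-join-atom : ∀ {a w w′ j} → IsAtom a → IsJoinElt _≤_ w′ a j → w ≤ j → ¬ a ≤ w → w ≤ w′
  ≤-join-atom {a} {w} {w′} ra w′∨a@(w′≤j , _) w≤j a≰w = atoms-reflects-≤ w≤j w′≤j λ {d} d∈w →
    [ (λ d∈w′ → d∈w′) , (λ { refl → ⊥-elim (a≰w (∈-atoms⇒≤ d∈w)) }) ]′
      (x∈p∪⁅y⁆⁻ (atoms w′) (subst (d ∈_) (atoms-join-atom ra w′∨a) (atoms-mono w≤j d∈w)))

  remove-atom : ∀ {a y} → IsAtom a → a ≤ y → ∃ λ w → ¬ a ≤ w × IsJoinElt _≤_ w a y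
  remove-atom {a} {y} ra a≤y = w , a≰w , join-from-atoms w≤y a≤y y⊆w∪a
    where
    w-spec = atoms-onto (atoms y - a) λ c → to ∈-atoms⇔ ∘ proj₁ ∘ to x∈p-y⇔
    w = proj₁ w-spec
    w≤y = proj₁ (proj₂ w-spec)
    atoms-w = proj₂ (proj₂ w-spec)
    a≰w : ¬ a ≤ w
    a≰w a≤w = x∉p-x (atoms y) a (subst (a ∈_) atoms-w (∈-atoms ra a≤w))
    y⊆w∪a : atoms y ⊆ atoms w ∪ atoms a
    y⊆w∪a {d} d∈y with d ≟ a
    ... | yes refl = q⊆p∪q (atoms w) _ (∈-atoms ra ≤-refl)
    ... | no  d≢a  = p⊆p∪q (atoms a) (subst (d ∈_) (sym atoms-w) (x∈p∧x≢y⇒x∈p-y d∈y d≢a))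

  joins-unique-below : ∀ {y z j₁ j₂ t} → IsJoinElt _≤_ y z j₁ → IsJoinElt _≤_ y z j₂ →
    j₁ ≤ t → j₂ ≤ t → j₁ ≡ j₂
  joins-unique-below j₁-join j₂-join j₁≤t j₂≤t =
    atoms-injective j₁≤t j₂≤t (trans (atoms-join j₁-join) (sym (atoms-join j₂-join)))

  exchange-diamond : ∀ {b c t t′ b′} → IsAtom c → ¬ c ≤ b → b ≤ t →
    ¬ c ≤ t′ → IsJoinElt _≤_ t′ c t → IsJoinElt _≤_ b c b′ → b′ ≤ t →
    IsJoinElt _≤_ t′ b′ t × IsMeetElt _≤_ t′ b′ b
  exchange-diamond {b} {c} {t} {t′} {b′} rc c≰b b≤t c≰t′ t′∨c b∨c b′≤t =
    join-from-atoms (proj₁ t′∨c) b′≤t t⊆t′∪b′ , meet-from-atoms b≤t′ (proj₁ b∨c) t′∩b′⊆b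
    where
    b≤t′ = ≤-join-atom rc t′∨c b≤t c≰b
    t⊆t′∪b′ : atoms t ⊆ atoms t′ ∪ atoms b′
    t⊆t′∪b′ {d} d∈t with x∈p∪⁅y⁆⁻ (atoms t′) (subst (d ∈_) (atoms-join-atom rc t′∨c) d∈t)
    ... | inj₁ d∈t′ = p⊆p∪q (atoms b′) d∈t′
    ... | inj₂ refl = q⊆p∪q (atoms t′) _ (∈-atoms rc (proj₁ (proj₂ b∨c)))
    t′∩b′⊆b : ∀ {d} → d ∈ atoms t′ → d ∈ atoms b′ → d ∈ atoms b
    t′∩b′⊆b {d} d∈t′ d∈b′ with x∈p∪⁅y⁆⁻ (atoms b) (subst (d ∈_) (atoms-join-atom rc b∨c) d∈b′)
    ... | inj₁ d∈b = d∈b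
    ... | inj₂ refl = ⊥-elim (c≰t′ (∈-atoms⇒≤ d∈t′))

module MatroidSchemeProperties {n : ℕ} (M : MatroidScheme n) where
  open MatroidScheme M
  open SimplicialPosetProperties S
  open import Data.Fin.Subset using (_∈_)
  open import Data.Fin.Subset.Properties using (_⊆?_)
  open Equivalence using (to)

  ρ-𝟘 : ρ 𝟘 ≡ 0
  ρ-𝟘 = ℕ.n≤0⇒n≡0 (subst (ρ 𝟘 ℕ.≤_) rank-𝟘 (M1 𝟘))

  ρ-atom≤1 : ∀ {a} → IsAtom a → ρ a ℕ.≤ 1
  ρ-atom≤1 ra = subst (_ ℕ.≤_) ra (M1 _)

  ρ-join-atom : ∀ {a w j} → IsAtom a → ¬ a ≤ w → IsJoinElt _≤_ w a j → ρ j ℕ.≤ ρ w ℕ.+ ρ a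
  ρ-join-atom {a} {w} {j} ra a≰w w∨a =
    ℕ.≤-trans (ℕ.m≤m+n (ρ j) (ρ 𝟘)) (M3 w a j 𝟘 w∨a (meet-atom ra a≰w))

  ρ-join≤ρ-meet : ∀ {y z v l} → IsJoinElt _≤_ y z v → IsMeetElt _≤_ y z l →
    ρ y ℕ.≤ ρ l → ρ z ℕ.≤ ρ l → ρ v ℕ.≤ ρ l
  ρ-join≤ρ-meet {y} {z} {v} {l} y∨z y∧z ρy≤ρl ρz≤ρl =
    ℕ.+-cancelʳ-≤ (ρ l) (ρ v) (ρ l) (ℕ.≤-trans (M3 y z v l y∨z y∧z) (ℕ.+-mono-≤ ρy≤ρl ρz≤ρl))

  -- If ρ m < ρ u, M5 gives an atom c ≤ u, c ≰ m and some j ∈ m ∨ c; as j satisfies P, j = m ≥ c.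
  ρ≤ρ-maximal-in : ∀ {m} (P : Fin n → Set) → (∀ v → P v → m ≤ v → v ≡ m) →
    ∀ {u} → (∀ {c j} → IsAtom c → c ≤ u → IsJoinElt _≤_ m c j → P j) → ρ u ℕ.≤ ρ m
  ρ≤ρ-maximal-in {m} P maximal {u} closed = ℕ.≮⇒≥ λ ρm<ρu →
    let c , rc , c≤u , c≰m , j , m∨c@(m≤j , c≤j , _) = M5 m u ρm<ρu in
    c≰m (subst (c ≤_) (maximal j (closed rc c≤u m∨c) m≤j) c≤j)

  ρ≤ρ-maximal : ∀ {m} → IsMaximal _≤_ m → ∀ u → ρ u ℕ.≤ ρ m
  ρ≤ρ-maximal m-max u = ρ≤ρ-maximal-in (λ _ → ⊤) (λ v _ → m-max v) (λ _ _ _ → tt)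

  ρ-maximal-≡ : ∀ {m m′} → IsMaximal _≤_ m → IsMaximal _≤_ m′ → ρ m ≡ ρ m′
  ρ-maximal-≡ m-max m′-max = ℕ.≤-antisym (ρ≤ρ-maximal m′-max _) (ρ≤ρ-maximal m-max _)

  ρ≤ρ-maximalDel : ∀ {a u′} → IsAtom a → IsMaximalDel a u′ → ∀ {w} → ¬ a ≤ w → ρ w ℕ.≤ ρ u′
  ρ≤ρ-maximalDel {a} {u′} ra (a≰u′ , u′-max) {w} a≰w = ρ≤ρ-maximal-in (λ v → ¬ a ≤ v) u′-max closed
    where
    closed : ∀ {c j} → IsAtom c → c ≤ w → IsJoinElt _≤_ u′ c j → ¬ a ≤ j
    closed {c} rc c≤w u′∨c a≤j
      with x∈p∪⁅y⁆⁻ (atoms u′) (subst (a ∈_) (atoms-join-atom rc u′∨c) (∈-atoms ra a≤j))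
    ... | inj₁ a∈u′ = a≰u′ (∈-atoms⇒≤ a∈u′)
    ... | inj₂ refl = a≰w c≤w

  maximalCon⇒maximal : ∀ {a u″} → IsMaximalCon a u″ → IsMaximal _≤_ u″
  maximalCon⇒maximal (a≤u″ , u″-max) v u″≤v = u″-max v (≤-trans a≤u″ u″≤v) u″≤v

  Independent? : ∀ x → Dec (Independent x)
  Independent? x = ρ x ℕ.≟ rank x

  -- Going down from m, remove an atom c ∈ t ∖ b from t to get t′; as b′ = b ∨ c is dependent, M3 on
  -- t′ ∨ b′ = t, t′ ∧ b′ = b gives ρ t ≤ ρ t′ = ρ b.
  ρ≡ρ-maximal-independent : ∀ {b m} → Independent b → b ≤ m →
    (∀ v → b ≤ v → v ≤ m → Independent v → v ≡ b) → ρ m ≡ ρ b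
  ρ≡ρ-maximal-independent {b} {m} ib b≤m b-max = go (suc (rank m)) m ℕ.≤-refl b≤m ≤-refl
    where
    go : ∀ k t → rank t < k → b ≤ t → t ≤ m → ρ t ≡ ρ b
    go (suc k) t rt<1+k b≤t t≤m with atoms t ⊆? atoms b
    ... | yes t⊆b = cong ρ (antisym (atoms-reflects-≤ ≤-refl b≤t t⊆b) b≤t)
    ... | no  t⊈b = ℕ.≤-antisym ρt≤ρb (M2 b t b≤t)
      where
      c-spec = p⊈q⇒∃∈p∉q t⊈b
      c = proj₁ c-spec
      rc = proj₁ (to ∈-atoms⇔ (proj₁ (proj₂ c-spec)))
      c≤t = proj₂ (to ∈-atoms⇔ (proj₁ (proj₂ c-spec)))
      c≰b : ¬ c ≤ b
      c≰b = proj₂ (proj₂ c-spec) ∘ ∈-atoms rc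
      t′-spec = remove-atom rc c≤t
      t′ = proj₁ t′-spec
      c≰t′ = proj₁ (proj₂ t′-spec)
      t′∨c = proj₂ (proj₂ t′-spec)
      b′-spec = join-below b≤t c≤t
      b′ = proj₁ b′-spec
      b′≤t = proj₁ (proj₂ b′-spec)
      b∨c = proj₁ (proj₂ (proj₂ b′-spec))
      diamond = exchange-diamond rc c≰b b≤t c≰t′ t′∨c b∨c b′≤t
      ρt′≡ρb : ρ t′ ≡ ρ b
      ρt′≡ρb = go k t′ (subst (ℕ._≤ k) (rank-join-atom rc c≰t′ t′∨c) (ℕ.≤-pred rt<1+k))
                 (proj₁ (proj₂ diamond)) (≤-trans (proj₁ t′∨c) t≤m)
      b′-dependent : ¬ Independent b′
      b′-dependent ib′ = c≰b (subst (c ≤_) (b-max b′ (proj₁ b∨c) (≤-trans b′≤t t≤m) ib′) (proj₁ (proj₂ b∨c)))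
      ρb′≤ρb : ρ b′ ℕ.≤ ρ b
      ρb′≤ρb = ℕ.≤-pred (begin-strict
        ρ b′          <⟨ ℕ.≤∧≢⇒< (M1 b′) b′-dependent ⟩
        rank b′       ≡⟨ rank-join-atom rc c≰b b∨c ⟩
        suc (rank b)  ≡⟨ cong suc ib ⟨
        suc (ρ b)     ∎)
        where open ℕ.≤-Reasoning
      ρt≤ρb : ρ t ℕ.≤ ρ b
      ρt≤ρb = ρ-join≤ρ-meet (proj₁ diamond) (proj₂ diamond) (ℕ.≤-reflexive ρt′≡ρb) ρb′≤ρb

  exists-maximal-above : ∀ {P : Fin n → Set} → (∀ x → Dec (P x)) → ∀ {c} → P c →
    ∃ λ m → MaximalIn _≤_ P m × c ≤ m
  exists-maximal-above = maximal-above isPartialOrder _≤?_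

  𝟘-independent : Independent 𝟘
  𝟘-independent = trans ρ-𝟘 (sym rank-𝟘)

  basis-above : ∀ {x} → Independent x → ∃ λ B → IsBasis B × x ≤ B
  basis-above ix = let B , (iB , B-max) , x≤B = exists-maximal-above Independent? ix in
    B , (iB , λ v B≤v iv → B-max v iv B≤v) , x≤B

  ρ-basis : ∀ {B u} → IsBasis B → IsMaximal _≤_ u → ρ B ≡ ρ u
  ρ-basis {B} {u} (iB , B-max) u-max =
    let m , (_ , m-max) , B≤m = exists-maximal-above {P = λ _ → ⊤} (λ _ → yes tt) tt in
    trans (sym (ρ≡ρ-maximal-independent iB B≤m λ v B≤v _ iv → B-max v B≤v iv))
          (ρ-maximal-≡ (λ v → m-max v tt) u-max)

  IsBasis? : ∀ b → Dec (IsBasis b)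
  IsBasis? b = Independent? b ×-dec all? λ v → b ≤? v →-dec (Independent? v →-dec v ≟ b)

  non-isthmus⇒avoiding-basis : ∀ {a} → ¬ IsIsthmus a → ∃ λ b → IsBasis b × ¬ a ≤ b
  non-isthmus⇒avoiding-basis {a} ¬isthmus
    with ¬∀⟶∃¬ n (λ b → IsBasis b → a ≤ b) (λ b → IsBasis? b →-dec a ≤? b) ¬isthmus
  ... | b , ¬[basis⇒a≤b] with IsBasis? b | a ≤? b
  ...   | yes basis | no a≰b = b , basis , a≰b
  ...   | yes _     | yes a≤b = contradiction (λ _ → a≤b) ¬[basis⇒a≤b]
  ...   | no ¬basis | _       = contradiction (λ basis → contradiction basis ¬basis) ¬[basis⇒a≤b]

  ρ-maximalDel-non-isthmus : ∀ {a u u′} → IsAtom a → ¬ IsIsthmus a →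
    IsMaximal _≤_ u → IsMaximalDel a u′ → ρ u′ ≡ ρ u
  ρ-maximalDel-non-isthmus {u′ = u′} ra ¬isthmus u-max u′-max =
    let b , basis , a≰b = non-isthmus⇒avoiding-basis ¬isthmus in
    ℕ.≤-antisym (ρ≤ρ-maximal u-max _) (subst (ℕ._≤ ρ u′) (ρ-basis basis u-max) (ρ≤ρ-maximalDel ra u′-max a≰b))

  ρ-maximal≤1+ρ-maximalDel : ∀ {a u u′ u″} → IsAtom a →
    IsMaximal _≤_ u → IsMaximalDel a u′ → IsMaximalCon a u″ → ρ u ℕ.≤ suc (ρ u′)
  ρ-maximal≤1+ρ-maximalDel {a} {u} {u′} {u″} ra u-max u′-max u″-max =
    let w , a≰w , w∨a = remove-atom ra (proj₁ u″-max) in begin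
      ρ u          ≡⟨ ρ-maximal-≡ u-max (maximalCon⇒maximal u″-max) ⟩
      ρ u″         ≤⟨ ρ-join-atom ra a≰w w∨a ⟩
      ρ w ℕ.+ ρ a  ≤⟨ ℕ.+-mono-≤ (ρ≤ρ-maximalDel ra u′-max a≰w) (ρ-atom≤1 ra) ⟩
      ρ u′ ℕ.+ 1   ≡⟨ ℕ.+-comm (ρ u′) 1 ⟩
      suc (ρ u′)   ∎
    where open ℕ.≤-Reasoning

  -- A maximal independent b ≤ u′ has ρ b = ρ u′; a basis B ≥ b lies above the isthmus a, and ρ u ≤ ρ u′
  -- would force B = b ≤ u′.
  ρ-maximalDel<ρ-maximal : ∀ {a u u′} → IsIsthmus a →
    IsMaximal _≤_ u → IsMaximalDel a u′ → ρ u′ < ρ u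
  ρ-maximalDel<ρ-maximal {a} {u} {u′} isthmus u-max (a≰u′ , _) = ℕ.≰⇒> λ ρu≤ρu′ →
    a≰u′ (≤-trans (isthmus B basis) (subst (_≤ u′) (b≡B ρu≤ρu′) b≤u′))
    where
    b-spec = exists-maximal-above (λ v → Independent? v ×-dec v ≤? u′) (𝟘-independent , 𝟘-min u′)
    b = proj₁ b-spec
    ib = proj₁ (proj₁ (proj₁ (proj₂ b-spec)))
    b≤u′ = proj₂ (proj₁ (proj₁ (proj₂ b-spec)))
    b-max = proj₂ (proj₁ (proj₂ b-spec))
    ρu′≡ρb : ρ u′ ≡ ρ b
    ρu′≡ρb = ρ≡ρ-maximal-independent ib b≤u′ λ v b≤v v≤u′ iv → b-max v (iv , v≤u′) b≤v
    B-spec = basis-above ib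
    B = proj₁ B-spec
    basis = proj₁ (proj₂ B-spec)
    b≡B : ρ u ℕ.≤ ρ u′ → b ≡ B
    b≡B ρu≤ρu′ = ≤∧rank≥⇒≡ (proj₂ (proj₂ B-spec)) (begin
      rank B ≡⟨ proj₁ basis ⟨
      ρ B    ≡⟨ ρ-basis basis u-max ⟩
      ρ u    ≤⟨ ρu≤ρu′ ⟩
      ρ u′   ≡⟨ ρu′≡ρb ⟩
      ρ b    ≡⟨ ib ⟩
      rank b ∎)
      where open ℕ.≤-Reasoning

  loop-dependent : ∀ {a w} → IsAtom a → IsLoop a → a ≤ w → ρ w < rank w
  loop-dependent {a} {w} ra loop a≤w = let w′ , a≰w′ , w′∨a = remove-atom ra a≤w in begin-strict
    ρ w           ≤⟨ ρ-join-atom ra a≰w′ w′∨a ⟩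
    ρ w′ ℕ.+ ρ a  ≡⟨ cong (ρ w′ ℕ.+_) loop ⟩
    ρ w′ ℕ.+ 0    ≡⟨ ℕ.+-identityʳ (ρ w′) ⟩
    ρ w′          ≤⟨ M1 w′ ⟩
    rank w′       <⟨ ℕ.n<1+n (rank w′) ⟩
    suc (rank w′) ≡⟨ rank-join-atom ra a≰w′ w′∨a ⟨
    rank w        ∎
    where open ℕ.≤-Reasoning

  isthmus⇒¬loop : ∀ {a} → IsAtom a → IsIsthmus a → ¬ IsLoop a
  isthmus⇒¬loop ra isthmus loop = let B , basis , _ = basis-above 𝟘-independent in
    ℕ.<⇒≢ (loop-dependent ra loop (isthmus B basis)) (proj₁ basis)

  module Loop {a} (ra : IsAtom a) (loop : IsLoop a) where

    ρ-join-loop : ∀ {w j} → ¬ a ≤ w → IsJoinElt _≤_ w a j → ρ j ≡ ρ w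
    ρ-join-loop {w} {j} a≰w w∨a = ℕ.≤-antisym ρj≤ρw (M2 w j (proj₁ w∨a))
      where
      ρj≤ρw : ρ j ℕ.≤ ρ w
      ρj≤ρw = subst (ρ j ℕ.≤_) (trans (cong (ρ w ℕ.+_) loop) (ℕ.+-identityʳ (ρ w))) (ρ-join-atom ra a≰w w∨a)

    join-loop : ∀ {w} → ¬ a ≤ w → ∃ λ j → IsJoinElt _≤_ w a j
    join-loop {w} a≰w = let j , a∨w = M4 a w 𝟘 (meet-sym (meet-atom ra a≰w)) (trans loop (sym ρ-𝟘)) in
      j , join-sym a∨w

    -- A maximal common lower bound ℓ ≥ w of two joins has ρ ℓ = ρ w, so M4 gives them a common upper bound.
    join-loop-unique : ∀ {w j₁ j₂} → ¬ a ≤ w → IsJoinElt _≤_ w a j₁ → IsJoinElt _≤_ w a j₂ → j₁ ≡ j₂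
    join-loop-unique {w} {j₁} {j₂} a≰w j₁-join j₂-join =
      let z , j₁≤z , j₂≤z , _ = M4 j₁ j₂ ℓ j₁∧j₂ ρj₁≡ρℓ in joins-unique-below j₁-join j₂-join j₁≤z j₂≤z
      where
      ℓ-spec = exists-maximal-above (λ v → v ≤? j₁ ×-dec v ≤? j₂) (proj₁ j₁-join , proj₁ j₂-join)
      ℓ = proj₁ ℓ-spec
      ℓ≤j₁ = proj₁ (proj₁ (proj₁ (proj₂ ℓ-spec)))
      ℓ≤j₂ = proj₂ (proj₁ (proj₁ (proj₂ ℓ-spec)))
      j₁∧j₂ : IsMeetElt _≤_ j₁ j₂ ℓ
      j₁∧j₂ = ℓ≤j₁ , ℓ≤j₂ , λ v v≤j₁ v≤j₂ → proj₂ (proj₁ (proj₂ ℓ-spec)) v (v≤j₁ , v≤j₂)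
      ρj₁≡ρℓ : ρ j₁ ≡ ρ ℓ
      ρj₁≡ρℓ = ℕ.≤-antisym (subst (ℕ._≤ ρ ℓ) (sym (ρ-join-loop a≰w j₁-join)) (M2 w ℓ (proj₂ (proj₂ ℓ-spec))))
                           (M2 ℓ j₁ ℓ≤j₁)

    toggle : Fin n → Fin n
    toggle w with a ≤? w
    ... | yes a≤w = proj₁ (remove-atom ra a≤w)
    ... | no  a≰w = proj₁ (join-loop a≰w)

    toggle-join : ∀ {w} → ¬ a ≤ w → IsJoinElt _≤_ w a (toggle w)
    toggle-join {w} a≰w with a ≤? w
    ... | yes a≤w = contradiction a≤w a≰w
    ... | no  a≰w = proj₂ (join-loop a≰w)

    toggle-remove : ∀ {v} → a ≤ v → ¬ a ≤ toggle v × IsJoinElt _≤_ (toggle v) a v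
    toggle-remove {v} a≤v with a ≤? v
    ... | yes a≤v = proj₂ (remove-atom ra a≤v)
    ... | no  a≰v = contradiction a≤v a≰v

    toggle-involutive : ∀ w → toggle (toggle w) ≡ w
    toggle-involutive w with a ≤? w
    ... | yes a≤w = let a≰v , v∨a = proj₂ (remove-atom ra a≤w) in join-loop-unique a≰v (toggle-join a≰v) v∨a
    ... | no  a≰w = let w∨a = proj₂ (join-loop a≰w) in
      let a≰w′ , w′∨a = toggle-remove (proj₁ (proj₂ w∨a)) in
      antisym (≤-join-atom ra w∨a (proj₁ w′∨a) a≰w′) (≤-join-atom ra w′∨a (proj₁ w∨a) a≰w)

open import Data.Fin.Permutation using (permutation)
open import Data.Integer using (ℤ; _+_; _*_; _-_; _^_; 0ℤ; 1ℤ)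
import Data.Integer.Properties as ℤ
open import Data.Integer.Tactic.RingSolver using (solve-∀)
open import Algebra.Properties.CommutativeSemigroup ℤ.*-commutativeSemigroup using (x∙yz≈y∙xz)
open import Algebra.Properties.Semiring.Sum ℤ.+-*-semiring
  using (sum; ∑-distrib-+; *-distribˡ-sum; sum-permute)

sumℤ≡sum : ∀ {n} (f : Fin n → ℤ) → sumℤ f ≡ sum f
sumℤ≡sum {zero}  f = refl
sumℤ≡sum {suc n} f = cong (f zero +_) (sumℤ≡sum (f ∘ suc))

sumℤ-cong : ∀ {n} {f g : Fin n → ℤ} → f ≗ g → sumℤ f ≡ sumℤ g
sumℤ-cong {zero}  f≗g = refl
sumℤ-cong {suc n} f≗g = cong₂ _+_ (f≗g zero) (sumℤ-cong (f≗g ∘ suc))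

sumℤ-+ : ∀ {n} (f g : Fin n → ℤ) → sumℤ (λ i → f i + g i) ≡ sumℤ f + sumℤ g
sumℤ-+ f g rewrite sumℤ≡sum (λ i → f i + g i) | sumℤ≡sum f | sumℤ≡sum g = ∑-distrib-+ f g

sumℤ-* : ∀ {n} c (f : Fin n → ℤ) → sumℤ (λ i → c * f i) ≡ c * sumℤ f
sumℤ-* c f rewrite sumℤ≡sum (λ i → c * f i) | sumℤ≡sum f = sym (*-distribˡ-sum c f)

sumℤ-involution : ∀ {n} (π : Fin n → Fin n) → (∀ i → π (π i) ≡ i) → ∀ f → sumℤ (f ∘ π) ≡ sumℤ f
sumℤ-involution π π-involutive f rewrite sumℤ≡sum (f ∘ π) | sumℤ≡sum f =
  sym (sum-permute f (permutation π π π-involutive π-involutive))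

module _ {n} {P : Fin n → Set} (P? : ∀ i → Dec (P i)) where

  select reject : (Fin n → ℤ) → Fin n → ℤ
  select f i = if does (P? i) then f i else 0ℤ
  reject f i = if does (P? i) then 0ℤ else f i

  sumℤ-select-reject : ∀ f → sumℤ f ≡ sumℤ (reject f) + sumℤ (select f)
  sumℤ-select-reject f = trans (sumℤ-cong split) (sumℤ-+ (reject f) (select f))
    where
    split : ∀ i → f i ≡ reject f i + select f i
    split i with does (P? i)
    ... | true  = sym (ℤ.+-identityˡ (f i))
    ... | false = sym (ℤ.+-identityʳ (f i))

  sumℤ-select-cong : ∀ {f g} → (∀ {i} → P i → f i ≡ g i) → sumℤ (select f) ≡ sumℤ (select g)
  sumℤ-select-cong {f} {g} f≡g = sumℤ-cong pointwise
    where
    pointwise : ∀ i → select f i ≡ select g i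
    pointwise i with P? i
    ... | yes Pi = f≡g Pi
    ... | no  _  = refl

  sumℤ-select-scale : ∀ c {f g} → (∀ {i} → P i → f i ≡ c * g i) → sumℤ (select f) ≡ c * sumℤ (select g)
  sumℤ-select-scale c {f} {g} f≡cg = trans (sumℤ-cong pointwise) (sumℤ-* c (select g))
    where
    pointwise : ∀ i → select f i ≡ c * select g i
    pointwise i with P? i
    ... | yes Pi = f≡cg Pi
    ... | no  _  = sym (ℤ.*-zeroʳ c)

  sumℤ-reject-scale : ∀ c {f g} → (∀ {i} → ¬ P i → f i ≡ c * g i) → sumℤ (reject f) ≡ c * sumℤ (reject g)
  sumℤ-reject-scale c {f} {g} f≡cg = trans (sumℤ-cong pointwise) (sumℤ-* c (reject g))
    where
    pointwise : ∀ i → reject f i ≡ c * reject g i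
    pointwise i with P? i
    ... | yes _  = sym (ℤ.*-zeroʳ c)
    ... | no ¬Pi = f≡cg ¬Pi

module TutteRecursion {n} (M : MatroidScheme n) (x y : ℤ) where
  open MatroidScheme M
  open SimplicialPosetProperties S
  open MatroidSchemeProperties M

  X Y : ℤ
  X = x - 1ℤ
  Y = y - 1ℤ

  monomial : ℕ → ℕ → ℕ → ℤ
  monomial r s t = X ^ (r ∸ s) * Y ^ (t ∸ s)

  monomial-pred : ∀ r {s} t → 1 ℕ.≤ s → monomial r s t ≡ monomial (r ∸ 1) (s ∸ 1) (t ∸ 1)
  monomial-pred r {suc s} t _ =
    cong₂ (λ e f → X ^ e * Y ^ f) (sym (ℕ.∸-+-assoc r 1 s)) (sym (ℕ.∸-+-assoc t 1 s))

  monomial-suc-r : ∀ {r s} t → s ℕ.≤ r → monomial (suc r) s t ≡ X * monomial r s t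
  monomial-suc-r {r} {s} t s≤r = begin
    X ^ (suc r ∸ s) * Y ^ (t ∸ s)       ≡⟨ cong (λ e → X ^ e * Y ^ (t ∸ s)) (ℕ.+-∸-assoc 1 s≤r) ⟩
    X * X ^ (r ∸ s) * Y ^ (t ∸ s)       ≡⟨ ℤ.*-assoc X (X ^ (r ∸ s)) (Y ^ (t ∸ s)) ⟩
    X * monomial r s t                  ∎
    where open ≡-Reasoning

  monomial-suc-t : ∀ r {s t} → s ℕ.≤ t → monomial r s (suc t) ≡ Y * monomial r s t
  monomial-suc-t r {s} {t} s≤t = begin
    X ^ (r ∸ s) * Y ^ (suc t ∸ s)       ≡⟨ cong (λ e → X ^ (r ∸ s) * Y ^ e) (ℕ.+-∸-assoc 1 s≤t) ⟩
    X ^ (r ∸ s) * (Y * Y ^ (t ∸ s))     ≡⟨ x∙yz≈y∙xz (X ^ (r ∸ s)) Y (Y ^ (t ∸ s)) ⟩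
    Y * monomial r s t                  ∎
    where open ≡-Reasoning

  monomial-pred-t : ∀ r {s t} → s < t → monomial r s t ≡ Y * monomial r s (t ∸ 1)
  monomial-pred-t r {t = suc t} (s≤s s≤t) = monomial-suc-t r s≤t

  module AtAtom {a u u′ u″} (ra : IsAtom a)
    (u-max : IsMaximal _≤_ u) (u′-max : IsMaximalDel a u′) (u″-max : IsMaximalCon a u″) where

    ρu″≡ρu : ρ u″ ≡ ρ u
    ρu″≡ρu = ρ-maximal-≡ (maximalCon⇒maximal u″-max) u-max

    term contracted : Fin n → ℤ
    term w = monomial (ρ u) (ρ w) (rank w)
    contracted w = monomial (ρ u″ ∸ ρ a) (ρ w ∸ ρ a) (rank w ∸ 1)

    tutteAbove : ℤ
    tutteAbove = sumℤ (select (a ≤?_) term)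

    tutte-split : tutte M (ρ u) x y ≡ tutteDel M a (ρ u) x y + tutteAbove
    tutte-split = sumℤ-select-reject (a ≤?_) term

    tutteAbove-non-loop : ¬ IsLoop a → tutteAbove ≡ tutteCon M a (ρ u″ ∸ ρ a) x y
    tutteAbove-non-loop ¬loop = sumℤ-select-cong (a ≤?_) pointwise
      where
      ρa≡1 : ρ a ≡ 1
      ρa≡1 = ℕ.≤-antisym (ρ-atom≤1 ra) (ℕ.n≢0⇒n>0 ¬loop)
      pointwise : ∀ {w} → a ≤ w → term w ≡ contracted w
      pointwise {w} a≤w rewrite ρa≡1 | ρu″≡ρu =
        monomial-pred (ρ u) (rank w) (subst (ℕ._≤ ρ w) ρa≡1 (M2 a w a≤w))

    tutteAbove-loop : IsLoop a → tutteAbove ≡ Y * tutteCon M a (ρ u″ ∸ ρ a) x y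
    tutteAbove-loop loop = sumℤ-select-scale (a ≤?_) Y pointwise
      where
      pointwise : ∀ {w} → a ≤ w → term w ≡ Y * contracted w
      pointwise {w} a≤w rewrite loop | ρu″≡ρu = monomial-pred-t (ρ u) (loop-dependent ra loop a≤w)

    tutteDel-isthmus : IsIsthmus a → tutteDel M a (ρ u) x y ≡ X * tutteDel M a (ρ u′) x y
    tutteDel-isthmus isthmus = sumℤ-reject-scale (a ≤?_) X pointwise
      where
      ρu≡suc[ρu′] : ρ u ≡ suc (ρ u′)
      ρu≡suc[ρu′] = ℕ.≤-antisym (ρ-maximal≤1+ρ-maximalDel ra u-max u′-max u″-max)
                                (ρ-maximalDel<ρ-maximal isthmus u-max u′-max)
      pointwise : ∀ {w} → ¬ a ≤ w → term w ≡ X * monomial (ρ u′) (ρ w) (rank w)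
      pointwise {w} a≰w = trans (cong (λ r → monomial r (ρ w) (rank w)) ρu≡suc[ρu′])
                                (monomial-suc-r (rank w) (ρ≤ρ-maximalDel ra u′-max a≰w))

    -- Deleting a loop and contracting it give the same sum, reindexed by w ↦ w ∨ a.
    tutteDel-loop : IsLoop a → tutteDel M a (ρ u) x y ≡ tutteCon M a (ρ u″ ∸ ρ a) x y
    tutteDel-loop loop = trans (sumℤ-cong toggled) (sumℤ-involution toggle toggle-involutive con)
      where
      open Loop ra loop
      con : Fin n → ℤ
      con = select (a ≤?_) contracted
      con-≤ : ∀ {v} → a ≤ v → con v ≡ contracted v
      con-≤ {v} a≤v = cong (λ b → if b then contracted v else 0ℤ) (dec-true (a ≤? v) a≤v)
      con-≰ : ∀ {v} → ¬ a ≤ v → con v ≡ 0ℤ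
      con-≰ {v} a≰v = cong (λ b → if b then contracted v else 0ℤ) (dec-false (a ≤? v) a≰v)
      term≡contracted-join : ∀ {w} → ¬ a ≤ w → term w ≡ contracted (toggle w)
      term≡contracted-join {w} a≰w = sym (begin
        monomial (ρ u″ ∸ ρ a) (ρ j ∸ ρ a) (rank j ∸ 1)
          ≡⟨ cong (λ e → monomial (ρ u″ ∸ e) (ρ j ∸ e) (rank j ∸ 1)) loop ⟩
        monomial (ρ u″) (ρ j) (rank j ∸ 1)
          ≡⟨ cong₂ (λ r s → monomial r s (rank j ∸ 1)) ρu″≡ρu (ρ-join-loop a≰w w∨a) ⟩
        monomial (ρ u) (ρ w) (rank j ∸ 1)
          ≡⟨ cong (λ t → monomial (ρ u) (ρ w) (t ∸ 1)) (rank-join-atom ra a≰w w∨a) ⟩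
        monomial (ρ u) (ρ w) (rank w)
          ∎)
        where
        j = toggle w
        w∨a = toggle-join a≰w
        open ≡-Reasoning
      toggled : ∀ w → reject (a ≤?_) term w ≡ con (toggle w)
      toggled w = by-cases (a ≤? w)
        where
        by-cases : (a≤?w : Dec (a ≤ w)) → (if does a≤?w then 0ℤ else term w) ≡ con (toggle w)
        by-cases (yes a≤w) = sym (con-≰ (proj₁ (toggle-remove a≤w)))
        by-cases (no  a≰w) = trans (term≡contracted-join a≰w) (sym (con-≤ (proj₁ (proj₂ (toggle-join a≰w)))))

c+[y-1]c≡yc : ∀ c y → c + (y - 1ℤ) * c ≡ y * c
c+[y-1]c≡yc = solve-∀

theorem10p2 : ∀ {n : ℕ} (M : MatroidScheme n) (a : Fin n) →
    MatroidScheme.IsAtom M a →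
    ∀ (u u′ u″ : Fin n) →
    IsMaximal (MatroidScheme._≤_ M) u →
    MatroidScheme.IsMaximalDel M a u′ →
    MatroidScheme.IsMaximalCon M a u″ →
    ∀ (x y : ℤ) →
    ((¬ MatroidScheme.IsLoop M a → ¬ MatroidScheme.IsIsthmus M a →
        tutte M (MatroidScheme.ρ M u) x y
          ≡ tutteDel M a (MatroidScheme.ρ M u′) x y
            + tutteCon M a (MatroidScheme.ρ M u″ Data.Nat.∸ MatroidScheme.ρ M a) x y)
    × (MatroidScheme.IsLoop M a →
        tutte M (MatroidScheme.ρ M u) x y
          ≡ y * tutteCon M a (MatroidScheme.ρ M u″ Data.Nat.∸ MatroidScheme.ρ M a) x y)
    × (MatroidScheme.IsIsthmus M a →
        tutte M (MatroidScheme.ρ M u) x y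
          ≡ (x - 1ℤ) * tutteDel M a (MatroidScheme.ρ M u′) x y
            + tutteCon M a (MatroidScheme.ρ M u″ Data.Nat.∸ MatroidScheme.ρ M a) x y))
theorem10p2 M a ra u u′ u″ u-max u′-max u″-max x y =
  (λ ¬loop ¬isthmus → trans tutte-split (cong₂ _+_
     (cong (λ r → tutteDel M a r x y) (sym (ρ-maximalDel-non-isthmus ra ¬isthmus u-max u′-max)))
     (tutteAbove-non-loop ¬loop))) ,
  (λ loop → trans tutte-split (trans (cong₂ _+_ (tutteDel-loop loop) (tutteAbove-loop loop))
     (c+[y-1]c≡yc _ y))) ,
  (λ isthmus → trans tutte-split (cong₂ _+_ (tutteDel-isthmus isthmus)
     (tutteAbove-non-loop (isthmus⇒¬loop ra isthmus))))
  where
  open MatroidScheme M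
  open MatroidSchemeProperties M
  open TutteRecursion M x y
  open AtAtom ra u-max u′-max u″-max
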